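{- Let $q=(q_1,\ldots,q_n)$ be a weakly increasing sequence of positive integers such that $q_j$ divides $1+\sum_{i\neq j}q_i$ for every $j$, and let $\Delta_{(1,q)}:=\operatorname{conv}\{e_1,\ldots,e_n,-\sum_{i=1}^n q_ie_i\}\subset\mathbb{R}^n$ (a reflexive simplex). Then $\Delta_{(1,q)}$ has the integer decomposition property if and only if the following holds: for every $j=1,\ldots,n$ and every $b\in\{1,\ldots,q_j-1\}$ satisfying \[ b\left(\frac{1+\sum_{i\neq j}q_i}{q_j}\right)-\sum_{i\neq j}\left\lfloor\frac{bq_i}{q_j}\right\rfloor\ \ge\ 2, \] there exists a positive integer $c<b$ such that \[ \left\lfloor\frac{bq_i}{q_j}\right\rfloor-\left\lfloor\frac{cq_i}{q_j}\right\rfloor=\left\lfloor\frac{(b-c)q_i}{q_j}\right\rfloor\quad\text{for all } 1\le i\le n,\ i\neq j, \] and \[ c\left(\frac{1+\sum_{i\neq j}q_i}{q_j}\right)-\sum_{i\neq j}\left\lfloor\frac{cq_i}{q_j}\right\rfloor=1 . \]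
   Context: $e_i$ is the $i$-th standard basis vector of $\mathbb{R}^n$. A lattice polytope $P\subset\mathbb{R}^n$ has the integer decomposition property (is IDP) if for every positive integer $m$ and every $w\in mP\cap\mathbb{Z}^n$ there exist $x_1,\ldots,x_m\in P\cap\mathbb{Z}^n$ with $w=x_1+\cdots+x_m$. All sums $\sum_{i\neq j}$ range over $1\le i\le n$, $i\ne j$. -}

module Defs where

open import Data.Nat as ℕ using (ℕ; zero; suc)
open import Data.Nat.DivMod using (_/_)
open import Data.Integer as ℤ using (ℤ; +_)
open import Data.Rational as ℚ using (ℚ; 0ℚ)
open import Data.Fin using (Fin; zero; suc; _≟_)
open import Data.Product using (Σ; _×_)
open import Relation.Binary.PropositionalEquality using (_≡_)
open import Relation.Nullary using (yes; no)

∑ℕ : {k : ℕ} → (Fin k → ℕ) → ℕ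
∑ℕ {zero}  f = 0
∑ℕ {suc k} f = f zero ℕ.+ ∑ℕ (λ i → f (suc i))

∑ℤ : {k : ℕ} → (Fin k → ℤ) → ℤ
∑ℤ {zero}  f = + 0
∑ℤ {suc k} f = f zero ℤ.+ ∑ℤ (λ i → f (suc i))

∑ℚ : {k : ℕ} → (Fin k → ℚ) → ℚ
∑ℚ {zero}  f = 0ℚ
∑ℚ {suc k} f = f zero ℚ.+ ∑ℚ (λ i → f (suc i))

∑≠ : {n : ℕ} → Fin n → (Fin n → ℕ) → ℕ
∑≠ j f = ∑ℕ (λ i → helper (i ≟ j) (f i))
  where
  helper : {A : Set} → Relation.Nullary.Dec A → ℕ → ℕ
  helper (yes _) _ = 0
  helper (no _)  x = x

-- floor division ⌊ a / d ⌋ (only used with d ≥ 1; convention a div 0 = 0)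
_div_ : ℕ → ℕ → ℕ
a div zero    = 0
a div (suc d) = a / suc d

toℚ : ℤ → ℚ
toℚ z = z ℚ./ 1

e : {n : ℕ} → Fin n → Fin n → ℤ
e i k with i ≟ k
... | yes _ = + 1
... | no  _ = + 0

-- vertices of Δ_(1,q): vertex 0 is -∑ q_i e_i, vertex (suc i) is e_i
simplexVerts : {n : ℕ} → (Fin n → ℕ) → Fin (suc n) → Fin n → ℤ
simplexVerts q zero    k = ℤ.- (+ q k)
simplexVerts q (suc i) k = e i k

-- w ∈ m · conv{V_0,…,V_{r-1}}  (w an integer point, coefficients rational)
InDilate : {n r : ℕ} → (Fin r → Fin n → ℤ) → ℕ → (Fin n → ℤ) → Set
InDilate {n} {r} V m w =
  Σ (Fin r → ℚ) λ l →
    (∀ k → 0ℚ ℚ.≤ l k) ×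
    (∑ℚ l ≡ toℚ (+ m)) ×
    (∀ i → ∑ℚ (λ k → l k ℚ.* toℚ (V k i)) ≡ toℚ (w i))

IDP : {n r : ℕ} → (Fin r → Fin n → ℤ) → Set
IDP {n} V =
  ∀ (m : ℕ) → 1 ℕ.≤ m → (w : Fin n → ℤ) → InDilate V m w →
    Σ (Fin m → Fin n → ℤ) λ x →
      (∀ t → InDilate V 1 (x t)) × (∀ i → ∑ℤ (λ t → x t i) ≡ w i)

-- the arithmetic condition of the theorem
-- (1 + ∑_{i≠j} q_i)/q_j is exact by the divisibility hypothesis;
-- "X - Y ≥ 2" is written Y + 2 ≤ X, "X - Y = 1" as X ≡ Y + 1,
-- "A - B = C" as A ≡ B + C (all quantities natural numbers)
Cond : {n : ℕ} → (Fin n → ℕ) → Set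
Cond {n} q =
  ∀ (j : Fin n) (b : ℕ) → 1 ℕ.≤ b → b ℕ.< q j →
    ∑≠ j (λ i → (b ℕ.* q i) div q j) ℕ.+ 2
      ℕ.≤ b ℕ.* ((1 ℕ.+ ∑≠ j q) div q j) →
    Σ ℕ λ c → (1 ℕ.≤ c) × (c ℕ.< b) ×
      (∀ i → ¬≡ i j →
        (b ℕ.* q i) div q j ≡ (c ℕ.* q i) div q j ℕ.+ ((b ℕ.∸ c) ℕ.* q i) div q j) ×
      (c ℕ.* ((1 ℕ.+ ∑≠ j q) div q j) ≡ ∑≠ j (λ i → (c ℕ.* q i) div q j) ℕ.+ 1)
  where
  open import Relation.Nullary using (¬_)
  ¬≡ : Fin n → Fin n → Set
  ¬≡ a b = ¬ (a ≡ b)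

-- Let N = 1 + Σ q_i. Every w ∈ ℤⁿ is uniquely a combination of the vertices -q, e_1, ..., e_n with
-- total weight M, with coefficients β(M, w) / N for an integer vector β(M, w) that is additive in
-- (M, w); and w ∈ M·Δ iff β(M, w) ≥ 0. Hence a lattice point x of Δ splits off w ∈ M·Δ, leaving a
-- lattice point of (M - 1)·Δ, iff β(1, x) ≤ β(M, w). The vertices have β = N·δ_k, the origin has
-- β = (1, q), and q_i divides β_i(M, w) since q_i divides N. So a lattice point of M·Δ (M ≥ 2) can
-- fail to split only if all its β are below N and some β_{e_j} vanishes; such a point is -⌊c q / q_j⌋,
-- on the facet opposite e_j, with c (1 + Σ_{i≠j} q_i) / q_j - Σ_{i≠j} ⌊c q_i / q_j⌋ = M, and lattice
-- points of Δ and (M - 1)·Δ summing to it are again of this form, with c = c′ + c″. Thus IDP holds iff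
-- each such point of height M ≥ 2 splits into points of heights 1 and M - 1, which is the condition.

module Submission where

open import Defs
open import Data.Nat using (ℕ; suc; _≤_)
open import Data.Nat.Divisibility using (_∣_)
open import Data.Fin using (Fin)
open import Data.Fin as F using ()
open import Data.Product using (_×_)

open import Algebra.Bundles using (CommutativeMonoid)
open import Data.Empty using (⊥-elim)
open import Data.Fin using (zero; suc; _≟_)
open import Data.Fin.Properties using (any?)
open import Data.Integer as ℤ using (ℤ; +_; +0; +[1+_]; -[1+_])
import Data.Integer.Properties as ℤP
import Data.Integer.Tactic.RingSolver as ZS
open import Data.Nat as ℕ using (zero; _+_; _*_; _∸_; _<_; NonZero; z≤n; s≤s)
import Data.Nat.Coprimality as Coprime
open import Data.Nat.DivMod using (_/_; _%_; m%n<n; m≡m%n+[m/n]*n; m/n*n≡m; m*n/n≡m; m*n%n≡0)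
import Data.Nat.Properties as ℕP
import Data.Nat.Tactic.RingSolver as NS
open import Data.Product using (Σ; ∃; _,_; proj₁; proj₂)
open import Data.Rational as ℚ using (ℚ; 0ℚ; 1ℚ)
import Data.Rational.Properties as ℚP
open import Data.Rational.Solver using (module +-*-Solver)
open import Data.Rational.Unnormalised as ℚᵘ using (mkℚᵘ; *≡*)
import Data.Rational.Unnormalised.Properties as ℚᵘP
open import Function using (_∘_)
open import Relation.Binary.PropositionalEquality
open import Relation.Nullary using (¬_; yes; no)
open import Algebra.Properties.CommutativeSemigroup ℕP.+-commutativeSemigroup
  using () renaming (interchange to ℕ-+-interchange; x∙yz≈y∙xz to ℕ-x∙yz≈y∙xz)
open import Algebra.Properties.CommutativeSemigroup ℤP.+-commutativeSemigroup
  using () renaming (interchange to ℤ-+-interchange)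
open import Algebra.Properties.CommutativeSemigroup
  (CommutativeMonoid.commutativeSemigroup ℚP.+-0-commutativeMonoid)
  using () renaming (interchange to ℚ-+-interchange)

∑ℕ-cong : ∀ {k} {f g : Fin k → ℕ} → (∀ i → f i ≡ g i) → ∑ℕ f ≡ ∑ℕ g
∑ℕ-cong {zero}  f≗g = refl
∑ℕ-cong {suc k} f≗g = cong₂ _+_ (f≗g zero) (∑ℕ-cong (λ i → f≗g (suc i)))

∑ℕ-distrib-+ : ∀ {k} (f g : Fin k → ℕ) → ∑ℕ (λ i → f i + g i) ≡ ∑ℕ f + ∑ℕ g
∑ℕ-distrib-+ {zero}  f g = refl
∑ℕ-distrib-+ {suc k} f g =
  trans (cong (λ s → f zero + g zero + s) (∑ℕ-distrib-+ (λ i → f (suc i)) (λ i → g (suc i))))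
        (ℕ-+-interchange (f zero) (g zero) _ _)

mask : ∀ {k} → Fin k → (Fin k → ℕ) → Fin k → ℕ
mask j f i with i ≟ j
... | yes _ = 0
... | no  _ = f i

∑ℕ-mask : ∀ {k} (j : Fin k) (f : Fin k → ℕ) → ∑ℕ f ≡ f j + ∑ℕ (mask j f)
∑ℕ-mask {suc k} zero    f = refl
∑ℕ-mask {suc k} (suc j) f = begin
  f zero + ∑ℕ (λ i → f (suc i))
    ≡⟨ cong (λ s → f zero + s) (∑ℕ-mask j (λ i → f (suc i))) ⟩
  f zero + (f (suc j) + ∑ℕ (mask j (λ i → f (suc i))))
    ≡⟨ ℕ-x∙yz≈y∙xz (f zero) (f (suc j)) _ ⟩
  f (suc j) + (f zero + ∑ℕ (mask j (λ i → f (suc i))))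
    ≡⟨ cong (λ s → f (suc j) + (f zero + s)) (∑ℕ-cong (mask-suc j f)) ⟩
  f (suc j) + (f zero + ∑ℕ (λ i → mask (suc j) f (suc i)))
    ∎
  where
  open ≡-Reasoning
  mask-suc : ∀ {k} (j : Fin k) (f : Fin (suc k) → ℕ) i →
             mask j (λ i → f (suc i)) i ≡ mask (suc j) f (suc i)
  mask-suc j f i with i ≟ j
  ... | yes _ = refl
  ... | no  _ = refl

-- The summand of ∑≠ is a local function of Defs and cannot be named; the
-- underscore below is solved from the use of summand≡mask in ∑≠≡∑ℕ-mask.
mutual
  ∑≠≡∑ℕ-mask : ∀ {k} (j : Fin k) (f : Fin k → ℕ) → ∑≠ j f ≡ ∑ℕ (mask j f)
  ∑≠≡∑ℕ-mask j f = ∑ℕ-cong (summand≡mask j f)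

  summand≡mask : ∀ {k} (j : Fin k) (f : Fin k → ℕ) i → _ ≡ mask j f i
  summand≡mask j f i with i ≟ j
  ... | yes _ = refl
  ... | no  _ = refl

∑≠-split : ∀ {k} (j : Fin k) (f : Fin k → ℕ) → ∑ℕ f ≡ f j + ∑≠ j f
∑≠-split j f = trans (∑ℕ-mask j f) (cong (λ s → f j + s) (sym (∑≠≡∑ℕ-mask j f)))

∑ℤ-cong : ∀ {k} {f g : Fin k → ℤ} → (∀ i → f i ≡ g i) → ∑ℤ f ≡ ∑ℤ g
∑ℤ-cong {zero}  f≗g = refl
∑ℤ-cong {suc k} f≗g = cong₂ ℤ._+_ (f≗g zero) (∑ℤ-cong (λ i → f≗g (suc i)))

∑ℤ-distrib-+ : ∀ {k} (f g : Fin k → ℤ) → ∑ℤ (λ i → f i ℤ.+ g i) ≡ ∑ℤ f ℤ.+ ∑ℤ g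
∑ℤ-distrib-+ {zero}  f g = refl
∑ℤ-distrib-+ {suc k} f g =
  trans (cong (λ s → f zero ℤ.+ g zero ℤ.+ s) (∑ℤ-distrib-+ (λ i → f (suc i)) (λ i → g (suc i))))
        (ℤ-+-interchange (f zero) (g zero) _ _)

*-distribˡ-∑ℤ : ∀ {k} (c : ℤ) (f : Fin k → ℤ) → ∑ℤ (λ i → c ℤ.* f i) ≡ c ℤ.* ∑ℤ f
*-distribˡ-∑ℤ {zero}  c f = sym (ℤP.*-zeroʳ c)
*-distribˡ-∑ℤ {suc k} c f =
  trans (cong (λ s → c ℤ.* f zero ℤ.+ s) (*-distribˡ-∑ℤ c (λ i → f (suc i))))
        (sym (ℤP.*-distribˡ-+ c (f zero) _))

∑ℤ-zero : ∀ {k} → ∑ℤ {k} (λ _ → +0) ≡ +0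
∑ℤ-zero {zero}  = refl
∑ℤ-zero {suc k} = trans (ℤP.+-identityˡ _) (∑ℤ-zero {k})

∑ℤ-pos : ∀ {k} (f : Fin k → ℕ) → ∑ℤ (λ i → + f i) ≡ + ∑ℕ f
∑ℤ-pos {zero}  f = refl
∑ℤ-pos {suc k} f = trans (cong (λ s → + f zero ℤ.+ s) (∑ℤ-pos (λ i → f (suc i))))
                         (sym (ℤP.pos-+ (f zero) _))

∑ℤ-neg-pos : ∀ {k} (f : Fin k → ℕ) → ∑ℤ (λ i → ℤ.- + f i) ≡ ℤ.- + ∑ℕ f
∑ℤ-neg-pos {zero}  f = refl
∑ℤ-neg-pos {suc k} f =
  trans (cong (λ s → ℤ.- + f zero ℤ.+ s) (∑ℤ-neg-pos (λ i → f (suc i))))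
        (trans (sym (ℤP.neg-distrib-+ (+ f zero) _)) (cong ℤ.-_ (sym (ℤP.pos-+ (f zero) _))))

e-suc : ∀ {k} (i j : Fin k) → e (suc i) (suc j) ≡ e i j
e-suc i j with i ≟ j
... | yes _ = refl
... | no  _ = refl

∑ℤ-e : ∀ {k} (i : Fin k) → ∑ℤ (e i) ≡ + 1
∑ℤ-e {suc k} zero    = cong (ℤ._+_ (+ 1)) (∑ℤ-zero {k})
∑ℤ-e {suc k} (suc i) = trans (ℤP.+-identityˡ _) (trans (∑ℤ-cong (e-suc i)) (∑ℤ-e i))

fromℚᵘ-+ : ∀ x y → ℚ.fromℚᵘ (x ℚᵘ.+ y) ≡ ℚ.fromℚᵘ x ℚ.+ ℚ.fromℚᵘ y
fromℚᵘ-+ x y = ℚP.toℚᵘ-injective (ℚᵘP.≃-trans (ℚP.toℚᵘ-fromℚᵘ (x ℚᵘ.+ y)) (ℚᵘP.≃-sym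
  (ℚᵘP.≃-trans (ℚP.toℚᵘ-homo-+ (ℚ.fromℚᵘ x) (ℚ.fromℚᵘ y))
               (ℚᵘP.+-cong (ℚP.toℚᵘ-fromℚᵘ x) (ℚP.toℚᵘ-fromℚᵘ y)))))

fromℚᵘ-* : ∀ x y → ℚ.fromℚᵘ (x ℚᵘ.* y) ≡ ℚ.fromℚᵘ x ℚ.* ℚ.fromℚᵘ y
fromℚᵘ-* x y = ℚP.toℚᵘ-injective (ℚᵘP.≃-trans (ℚP.toℚᵘ-fromℚᵘ (x ℚᵘ.* y)) (ℚᵘP.≃-sym
  (ℚᵘP.≃-trans (ℚP.toℚᵘ-homo-* (ℚ.fromℚᵘ x) (ℚ.fromℚᵘ y))
               (ℚᵘP.*-cong (ℚP.toℚᵘ-fromℚᵘ x) (ℚP.toℚᵘ-fromℚᵘ y)))))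

fromℚᵘ-neg : ∀ x → ℚ.fromℚᵘ (ℚᵘ.- x) ≡ ℚ.- ℚ.fromℚᵘ x
fromℚᵘ-neg x = ℚP.toℚᵘ-injective (ℚᵘP.≃-trans (ℚP.toℚᵘ-fromℚᵘ (ℚᵘ.- x)) (ℚᵘP.≃-sym
  (ℚᵘP.≃-trans (ℚP.toℚᵘ-homo‿- (ℚ.fromℚᵘ x)) (ℚᵘP.-‿cong (ℚP.toℚᵘ-fromℚᵘ x)))))

-- toℚ a is definitionally ℚ.fromℚᵘ (mkℚᵘ a 0).
toℚ-+ : ∀ a b → toℚ (a ℤ.+ b) ≡ toℚ a ℚ.+ toℚ b
toℚ-+ a b = trans (ℚP.fromℚᵘ-cong {mkℚᵘ (a ℤ.+ b) 0} {mkℚᵘ a 0 ℚᵘ.+ mkℚᵘ b 0} (*≡* a+b≃))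
                  (fromℚᵘ-+ (mkℚᵘ a 0) (mkℚᵘ b 0))
  where
  a+b≃ : (a ℤ.+ b) ℤ.* + 1 ≡ (a ℤ.* + 1 ℤ.+ b ℤ.* + 1) ℤ.* + 1
  a+b≃ = cong (ℤ._* + 1) (cong₂ ℤ._+_ (sym (ℤP.*-identityʳ a)) (sym (ℤP.*-identityʳ b)))

toℚ-* : ∀ a b → toℚ (a ℤ.* b) ≡ toℚ a ℚ.* toℚ b
toℚ-* a b = trans (ℚP.fromℚᵘ-cong {mkℚᵘ (a ℤ.* b) 0} {mkℚᵘ a 0 ℚᵘ.* mkℚᵘ b 0} (*≡* refl))
                  (fromℚᵘ-* (mkℚᵘ a 0) (mkℚᵘ b 0))

toℚ-neg : ∀ a → toℚ (ℤ.- a) ≡ ℚ.- toℚ a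
toℚ-neg a = fromℚᵘ-neg (mkℚᵘ a 0)

toℚᵘ-toℚ : ∀ a → ℚ.toℚᵘ (toℚ a) ℚᵘ.≃ mkℚᵘ a 0
toℚᵘ-toℚ a = ℚP.toℚᵘ-fromℚᵘ (mkℚᵘ a 0)

toℚ-mono-≤ : ∀ {a b} → a ℤ.≤ b → toℚ a ℚ.≤ toℚ b
toℚ-mono-≤ {a} {b} a≤b = ℚP.toℚᵘ-cancel-≤
  (ℚᵘP.≤-respˡ-≃ (ℚᵘP.≃-sym (toℚᵘ-toℚ a)) (ℚᵘP.≤-respʳ-≃ (ℚᵘP.≃-sym (toℚᵘ-toℚ b))
    (ℚᵘ.*≤* (subst₂ ℤ._≤_ (sym (ℤP.*-identityʳ a)) (sym (ℤP.*-identityʳ b)) a≤b))))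

toℚ-cancel-≤ : ∀ {a b} → toℚ a ℚ.≤ toℚ b → a ℤ.≤ b
toℚ-cancel-≤ {a} {b} p
  with ℚᵘP.≤-respˡ-≃ (toℚᵘ-toℚ a) (ℚᵘP.≤-respʳ-≃ (toℚᵘ-toℚ b) (ℚP.toℚᵘ-mono-≤ p))
... | ℚᵘ.*≤* a≤b = subst₂ ℤ._≤_ (ℤP.*-identityʳ a) (ℤP.*-identityʳ b) a≤b

*-nonNeg : ∀ {x y} → 0ℚ ℚ.≤ x → 0ℚ ℚ.≤ y → 0ℚ ℚ.≤ x ℚ.* y
*-nonNeg {x} {y} 0≤x 0≤y =
  ℚP.nonNegative⁻¹ _ {{ℚP.nonNeg*nonNeg⇒nonNeg x {{ℚ.nonNegative 0≤x}} y {{ℚ.nonNegative 0≤y}}}}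

∑ℚ-cong : ∀ {k} {f g : Fin k → ℚ} → (∀ i → f i ≡ g i) → ∑ℚ f ≡ ∑ℚ g
∑ℚ-cong {zero}  f≗g = refl
∑ℚ-cong {suc k} f≗g = cong₂ ℚ._+_ (f≗g zero) (∑ℚ-cong (λ i → f≗g (suc i)))

∑ℚ-distrib-+ : ∀ {k} (f g : Fin k → ℚ) → ∑ℚ (λ i → f i ℚ.+ g i) ≡ ∑ℚ f ℚ.+ ∑ℚ g
∑ℚ-distrib-+ {zero}  f g = sym (ℚP.+-identityˡ 0ℚ)
∑ℚ-distrib-+ {suc k} f g =
  trans (cong (λ s → f zero ℚ.+ g zero ℚ.+ s) (∑ℚ-distrib-+ (λ i → f (suc i)) (λ i → g (suc i))))
        (ℚ-+-interchange (f zero) (g zero) _ _)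

*-distribˡ-∑ℚ : ∀ {k} (c : ℚ) (f : Fin k → ℚ) → ∑ℚ (λ i → c ℚ.* f i) ≡ c ℚ.* ∑ℚ f
*-distribˡ-∑ℚ {zero}  c f = sym (ℚP.*-zeroʳ c)
*-distribˡ-∑ℚ {suc k} c f =
  trans (cong (λ s → c ℚ.* f zero ℚ.+ s) (*-distribˡ-∑ℚ c (λ i → f (suc i))))
        (sym (ℚP.*-distribˡ-+ c (f zero) _))

∑ℚ-toℚ : ∀ {k} (f : Fin k → ℤ) → ∑ℚ (λ i → toℚ (f i)) ≡ toℚ (∑ℤ f)
∑ℚ-toℚ {zero}  f = refl
∑ℚ-toℚ {suc k} f = trans (cong (λ s → toℚ (f zero) ℚ.+ s) (∑ℚ-toℚ (λ i → f (suc i))))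
                         (sym (toℚ-+ (f zero) _))

∑ℚ-select : ∀ {k} (g : Fin k → ℚ) (i : Fin k) → ∑ℚ (λ j → g j ℚ.* toℚ (e j i)) ≡ g i
∑ℚ-select {suc k} g zero = begin
  g zero ℚ.* 1ℚ ℚ.+ ∑ℚ (λ j → g (suc j) ℚ.* 0ℚ)
    ≡⟨ cong₂ ℚ._+_ (ℚP.*-identityʳ (g zero)) (∑ℚ-cong (λ j → ℚP.*-zeroʳ (g (suc j)))) ⟩
  g zero ℚ.+ ∑ℚ {k} (λ _ → 0ℚ)
    ≡⟨ cong (λ s → g zero ℚ.+ s) (∑ℚ-zero k) ⟩
  g zero ℚ.+ 0ℚ
    ≡⟨ ℚP.+-identityʳ (g zero) ⟩
  g zero ∎
  where
  open ≡-Reasoning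
  ∑ℚ-zero : ∀ k → ∑ℚ {k} (λ _ → 0ℚ) ≡ 0ℚ
  ∑ℚ-zero zero    = refl
  ∑ℚ-zero (suc k) = trans (ℚP.+-identityˡ _) (∑ℚ-zero k)
∑ℚ-select {suc k} g (suc i) = begin
  g zero ℚ.* 0ℚ ℚ.+ ∑ℚ (λ j → g (suc j) ℚ.* toℚ (e (suc j) (suc i)))
    ≡⟨ cong₂ ℚ._+_ (ℚP.*-zeroʳ (g zero))
                   (∑ℚ-cong (λ j → cong (λ z → g (suc j) ℚ.* toℚ z) (e-suc j i))) ⟩
  0ℚ ℚ.+ ∑ℚ (λ j → g (suc j) ℚ.* toℚ (e j i))
    ≡⟨ ℚP.+-identityˡ _ ⟩
  ∑ℚ (λ j → g (suc j) ℚ.* toℚ (e j i))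
    ≡⟨ ∑ℚ-select (λ j → g (suc j)) i ⟩
  g (suc i) ∎
  where open ≡-Reasoning

∑≠-additive : ∀ {k} (j : Fin k) (f g h : Fin k → ℕ) → (∀ i → ¬ i ≡ j → f i ≡ g i + h i) →
              ∑≠ j f ≡ ∑≠ j g + ∑≠ j h
∑≠-additive j f g h f≡g+h = begin
  ∑≠ j f                                  ≡⟨ ∑≠≡∑ℕ-mask j f ⟩
  ∑ℕ (mask j f)                           ≡⟨ ∑ℕ-cong mask-additive ⟩
  ∑ℕ (λ i → mask j g i + mask j h i)      ≡⟨ ∑ℕ-distrib-+ (mask j g) (mask j h) ⟩
  ∑ℕ (mask j g) + ∑ℕ (mask j h)           ≡⟨ cong₂ _+_ (∑≠≡∑ℕ-mask j g) (∑≠≡∑ℕ-mask j h) ⟨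
  ∑≠ j g + ∑≠ j h                         ∎
  where
  open ≡-Reasoning
  mask-additive : ∀ i → mask j f i ≡ mask j g i + mask j h i
  mask-additive i with i ≟ j
  ... | yes _  = refl
  ... | no i≢j = f≡g+h i i≢j

div≡/ : ∀ a d .{{_ : NonZero d}} → a div d ≡ a / d
div≡/ a (suc d) = refl

-1<z<1⇒z≡0 : ∀ {z} → ℤ.-1ℤ ℤ.< z → z ℤ.< ℤ.1ℤ → z ≡ +0
-1<z<1⇒z≡0 {+0}       _           _                  = refl
-1<z<1⇒z≡0 {+[1+ k ]} _           (ℤ.+<+ (s≤s ()))
-1<z<1⇒z≡0 { -[1+ k ]} (ℤ.-<- ()) _

-d<dz<d⇒z≡0 : ∀ d .{{_ : NonZero d}} {z} → ℤ.- + d ℤ.< + d ℤ.* z → + d ℤ.* z ℤ.< + d → z ≡ +0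
-d<dz<d⇒z≡0 d {z} -d<dz dz<d = -1<z<1⇒z≡0
  (ℤP.*-cancelˡ-<-nonNeg (+ d) (subst (ℤ._< + d ℤ.* z) -d≡d*-1 -d<dz))
  (ℤP.*-cancelˡ-<-nonNeg (+ d) (subst (+ d ℤ.* z ℤ.<_) (sym (ℤP.*-identityʳ (+ d))) dz<d))
  where
  -d≡d*-1 : ℤ.- + d ≡ + d ℤ.* ℤ.-1ℤ
  -d≡d*-1 = trans (sym (ℤP.-1*i≡-i (+ d))) (ℤP.*-comm ℤ.-1ℤ (+ d))

floor-unique : ∀ d .{{_ : NonZero d}} A y →
  +0 ℤ.≤ + d ℤ.* y ℤ.+ + A → + d ℤ.* y ℤ.+ + A ℤ.< + d → y ≡ ℤ.- + (A / d)
floor-unique d A y 0≤T T<d =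
  trans (alg y f) (trans (cong (λ z → z ℤ.- f) z≡0) (ℤP.+-identityˡ (ℤ.- f)))
  where
  T = + d ℤ.* y ℤ.+ + A
  f = + (A / d)
  r = + (A % d)
  A≡r+f*d : + A ≡ r ℤ.+ f ℤ.* + d
  A≡r+f*d = trans (cong +_ (m≡m%n+[m/n]*n A d))
                  (trans (ℤP.pos-+ (A % d) _) (cong (ℤ._+_ r) (ℤP.pos-* (A / d) d)))
  d*z≡T-r : + d ℤ.* (y ℤ.+ f) ≡ T ℤ.- r
  d*z≡T-r = trans (alg′ (+ d) y f r) (cong (λ a → + d ℤ.* y ℤ.+ a ℤ.- r) (sym A≡r+f*d))
    where
    alg′ : ∀ d y f r → d ℤ.* (y ℤ.+ f) ≡ d ℤ.* y ℤ.+ (r ℤ.+ f ℤ.* d) ℤ.- r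
    alg′ = ZS.solve-∀
  z≡0 : y ℤ.+ f ≡ +0
  z≡0 = -d<dz<d⇒z≡0 d
    (begin-strict
      ℤ.- + d          <⟨ ℤP.neg-mono-< (ℤ.+<+ (m%n<n A d)) ⟩
      ℤ.- r            ≡⟨ ℤP.+-identityˡ (ℤ.- r) ⟨
      +0 ℤ.- r         ≤⟨ ℤP.+-monoˡ-≤ (ℤ.- r) 0≤T ⟩
      T ℤ.- r          ≡⟨ d*z≡T-r ⟨
      + d ℤ.* (y ℤ.+ f) ∎)
    (begin-strict
      + d ℤ.* (y ℤ.+ f) ≡⟨ d*z≡T-r ⟩
      T ℤ.- r          ≤⟨ ℤP.i-j≤i T r ⟩
      T                <⟨ T<d ⟩
      + d              ∎)
    where open ℤP.≤-Reasoning
  alg : ∀ y f → y ≡ y ℤ.+ f ℤ.- f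
  alg = ZS.solve-∀

k*y+s≡0⇒y≡-c : ∀ k y {s} → +0 ℤ.≤ s → + suc k ℤ.* y ℤ.+ s ≡ +0 →
                ∃ λ c → y ≡ ℤ.- + c × s ≡ + (suc k * c)
k*y+s≡0⇒y≡-c k y {s} 0≤s ky+s≡0 =
  solve y (trans (alg (+ suc k ℤ.* y) s) (cong (λ t → t ℤ.- + suc k ℤ.* y) ky+s≡0)) 0≤s
  where
  alg : ∀ a s → s ≡ a ℤ.+ s ℤ.- a
  alg = ZS.solve-∀
  solve : ∀ y → s ≡ +0 ℤ.- + suc k ℤ.* y → +0 ℤ.≤ s → ∃ λ c → y ≡ ℤ.- + c × s ≡ + (suc k * c)
  solve +0        s≡ _ = 0 , refl ,
    trans s≡ (trans (cong (λ t → +0 ℤ.- t) (ℤP.*-zeroʳ (+ suc k))) (cong +_ (sym (ℕP.*-zeroʳ (suc k)))))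
  solve +[1+ m ]  refl ()
  solve -[1+ m ]  s≡ _ = suc m , refl , s≡

0<a*y⇒a≤a*y : ∀ a y → +0 ℤ.< + a ℤ.* y → + a ℤ.≤ + a ℤ.* y
0<a*y⇒a≤a*y a +0       0<a*0 = ⊥-elim (ℤP.<-irrefl (sym (ℤP.*-zeroʳ (+ a))) 0<a*0)
0<a*y⇒a≤a*y a +[1+ k ] _     = subst (+ a ℤ.≤_) (ℤP.pos-* a (suc k)) (ℤ.+≤+ (ℕP.m≤m*n a (suc k)))
0<a*y⇒a≤a*y a -[1+ k ] 0<a*y = ⊥-elim (ℤP.<⇒≱ 0<a*y
  (subst (+ a ℤ.* -[1+ k ] ℤ.≤_) (ℤP.*-zeroʳ (+ a)) (ℤP.*-monoˡ-≤-nonNeg (+ a) ℤ.-≤+)))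

neg-pos-+ : ∀ a b → ℤ.- + a ℤ.+ ℤ.- + b ≡ ℤ.- + (a + b)
neg-pos-+ a b = trans (sym (ℤP.neg-distrib-+ (+ a) (+ b))) (cong ℤ.-_ (sym (ℤP.pos-+ a b)))

a+[b-a]≡b : ∀ a b → a ℤ.+ (b ℤ.- a) ≡ b
a+[b-a]≡b = ZS.solve-∀

[a+b]-a≡b : ∀ a b → a ℤ.+ b ℤ.- a ≡ b
[a+b]-a≡b = ZS.solve-∀

module Barycentric {n : ℕ} (q : Fin n → ℕ) where

  N : ℕ
  N = suc (∑ℕ q)

  -- N times the coefficients of w as a combination of total weight M of the vertices
  -- simplexVerts q (vertex zero is -q, vertex suc i is e i).
  β : ℕ → (Fin n → ℤ) → Fin (suc n) → ℤ
  β M w zero    = + M ℤ.- ∑ℤ w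
  β M w (suc i) = + N ℤ.* w i ℤ.+ β M w zero ℤ.* + q i

  InΔ : ℕ → (Fin n → ℤ) → Set
  InΔ M w = ∀ k → +0 ℤ.≤ β M w k

  β-cong : ∀ M {w w′ : Fin n → ℤ} → (∀ i → w i ≡ w′ i) → ∀ k → β M w k ≡ β M w′ k
  β-cong M w≗w′ zero    = cong (λ s → + M ℤ.- s) (∑ℤ-cong w≗w′)
  β-cong M w≗w′ (suc i) = cong₂ (λ x s → + N ℤ.* x ℤ.+ s ℤ.* + q i) (w≗w′ i) (β-cong M w≗w′ zero)

  InΔ-cong : ∀ M {w w′ : Fin n → ℤ} → (∀ i → w i ≡ w′ i) → InΔ M w → InΔ M w′
  InΔ-cong M w≗w′ w∈ k = subst (ℤ._≤_ +0) (β-cong M w≗w′ k) (w∈ k)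

  β-+ : ∀ M M′ (w w′ : Fin n → ℤ) k → β (M + M′) (λ i → w i ℤ.+ w′ i) k ≡ β M w k ℤ.+ β M′ w′ k
  β-+ M M′ w w′ zero =
    trans (cong₂ (λ a s → a ℤ.- s) (ℤP.pos-+ M M′) (∑ℤ-distrib-+ w w′))
          (alg (+ M) (+ M′) (∑ℤ w) (∑ℤ w′))
    where
    alg : ∀ a b c d → a ℤ.+ b ℤ.- (c ℤ.+ d) ≡ (a ℤ.- c) ℤ.+ (b ℤ.- d)
    alg = ZS.solve-∀
  β-+ M M′ w w′ (suc i) =
    trans (cong (λ s → + N ℤ.* (w i ℤ.+ w′ i) ℤ.+ s ℤ.* + q i) (β-+ M M′ w w′ zero))
          (alg (+ N) (w i) (w′ i) (β M w zero) (β M′ w′ zero) (+ q i))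
    where
    alg : ∀ a x y s t b →
          a ℤ.* (x ℤ.+ y) ℤ.+ (s ℤ.+ t) ℤ.* b ≡ (a ℤ.* x ℤ.+ s ℤ.* b) ℤ.+ (a ℤ.* y ℤ.+ t ℤ.* b)
    alg = ZS.solve-∀

  InΔ-+ : ∀ {M M′} {w w′ : Fin n → ℤ} → InΔ M w → InΔ M′ w′ → InΔ (M + M′) (λ i → w i ℤ.+ w′ i)
  InΔ-+ {M} {M′} {w} {w′} w∈ w′∈ k =
    subst (ℤ._≤_ +0) (sym (β-+ M M′ w w′ k)) (ℤP.+-mono-≤ (w∈ k) (w′∈ k))

  β-origin₀ : ∀ M → β M (λ _ → +0) zero ≡ + M
  β-origin₀ M = trans (cong (λ s → + M ℤ.- s) (∑ℤ-zero {n})) (ℤP.+-identityʳ (+ M))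

  β-origin : ∀ M i → β M (λ _ → +0) (suc i) ≡ + (M * q i)
  β-origin M i = begin
    + N ℤ.* +0 ℤ.+ β M (λ _ → +0) zero ℤ.* + q i
      ≡⟨ cong₂ ℤ._+_ (ℤP.*-zeroʳ (+ N)) (cong (λ s → s ℤ.* + q i) (β-origin₀ M)) ⟩
    +0 ℤ.+ + M ℤ.* + q i
      ≡⟨ ℤP.+-identityˡ _ ⟩
    + M ℤ.* + q i
      ≡⟨ ℤP.pos-* M (q i) ⟨
    + (M * q i) ∎
    where open ≡-Reasoning

  InΔ-origin : ∀ M → InΔ M (λ _ → +0)
  InΔ-origin M zero    = subst (ℤ._≤_ +0) (sym (β-origin₀ M)) (ℤ.+≤+ z≤n)
  InΔ-origin M (suc i) = subst (ℤ._≤_ +0) (sym (β-origin M i)) (ℤ.+≤+ z≤n)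

  InΔ-∑ : ∀ m (X : Fin m → Fin n → ℤ) → (∀ t → InΔ 1 (X t)) → InΔ m (λ i → ∑ℤ (λ t → X t i))
  InΔ-∑ zero    X X∈ = InΔ-origin 0
  InΔ-∑ (suc m) X X∈ = InΔ-+ (X∈ zero) (InΔ-∑ m (λ t → X (suc t)) (λ t → X∈ (suc t)))

  β-vertex₀ : ∀ k → β 1 (simplexVerts q k) zero ≡ + N ℤ.* e k zero
  β-vertex₀ zero = begin
    + 1 ℤ.- ∑ℤ (λ i → ℤ.- + q i)
      ≡⟨ cong (λ s → + 1 ℤ.- s) (∑ℤ-neg-pos q) ⟩
    + 1 ℤ.- ℤ.- + ∑ℕ q
      ≡⟨ cong (ℤ._+_ (+ 1)) (ℤP.neg-involutive (+ ∑ℕ q)) ⟩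
    + N
      ≡⟨ ℤP.*-identityʳ (+ N) ⟨
    + N ℤ.* + 1 ∎
    where open ≡-Reasoning
  β-vertex₀ (suc j) = begin
    + 1 ℤ.- ∑ℤ (e j)
      ≡⟨ cong (λ s → + 1 ℤ.- s) (∑ℤ-e j) ⟩
    +0
      ≡⟨ ℤP.*-zeroʳ (+ N) ⟨
    + N ℤ.* +0 ∎
    where open ≡-Reasoning

  β-vertex : ∀ k k′ → β 1 (simplexVerts q k) k′ ≡ + N ℤ.* e k k′
  β-vertex k zero = β-vertex₀ k
  β-vertex zero (suc i) =
    trans (cong (λ s → + N ℤ.* ℤ.- + q i ℤ.+ s ℤ.* + q i) (trans (β-vertex₀ zero) (ℤP.*-identityʳ (+ N))))
          (alg (+ N) (+ q i))
    where
    alg : ∀ a b → a ℤ.* ℤ.- b ℤ.+ a ℤ.* b ≡ a ℤ.* +0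
    alg = ZS.solve-∀
  β-vertex (suc j) (suc i) = begin
    + N ℤ.* e j i ℤ.+ β 1 (e j) zero ℤ.* + q i
      ≡⟨ cong (λ s → + N ℤ.* e j i ℤ.+ s ℤ.* + q i) (trans (β-vertex₀ (suc j)) (ℤP.*-zeroʳ (+ N))) ⟩
    + N ℤ.* e j i ℤ.+ +0
      ≡⟨ ℤP.+-identityʳ _ ⟩
    + N ℤ.* e j i
      ≡⟨ cong (ℤ._*_ (+ N)) (e-suc j i) ⟨
    + N ℤ.* e (suc j) (suc i) ∎
    where open ≡-Reasoning

  InΔ-vertex : ∀ k → InΔ 1 (simplexVerts q k)
  InΔ-vertex k k′ = subst₂ ℤ._≤_ (ℤP.*-zeroʳ (+ N)) (sym (β-vertex k k′))
                           (ℤP.*-monoˡ-≤-nonNeg (+ N) (e-nonNeg k k′))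
    where
    e-nonNeg : ∀ k k′ → +0 ℤ.≤ e k k′
    e-nonNeg k k′ with k ≟ k′
    ... | yes _ = ℤ.+≤+ z≤n
    ... | no  _ = ℤ.+≤+ z≤n

  ∑β : ∀ M w → β M w zero ℤ.+ ∑ℤ (λ i → β M w (suc i)) ≡ + N ℤ.* + M
  ∑β M w = begin
    s ℤ.+ ∑ℤ (λ i → + N ℤ.* w i ℤ.+ s ℤ.* + q i)
      ≡⟨ cong (ℤ._+_ s) (∑ℤ-distrib-+ (λ i → + N ℤ.* w i) (λ i → s ℤ.* + q i)) ⟩
    s ℤ.+ (∑ℤ (λ i → + N ℤ.* w i) ℤ.+ ∑ℤ (λ i → s ℤ.* + q i))
      ≡⟨ cong (ℤ._+_ s) (cong₂ ℤ._+_ (*-distribˡ-∑ℤ (+ N) w) (*-distribˡ-∑ℤ s (λ i → + q i))) ⟩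
    s ℤ.+ (+ N ℤ.* ∑ℤ w ℤ.+ s ℤ.* ∑ℤ (λ i → + q i))
      ≡⟨ cong (λ Q → s ℤ.+ (+ N ℤ.* ∑ℤ w ℤ.+ s ℤ.* Q)) (∑ℤ-pos q) ⟩
    s ℤ.+ (+ N ℤ.* ∑ℤ w ℤ.+ s ℤ.* + ∑ℕ q)
      ≡⟨ alg (+ M) (∑ℤ w) (+ ∑ℕ q) ⟩
    (+ 1 ℤ.+ + ∑ℕ q) ℤ.* + M ∎
    where
    open ≡-Reasoning
    s = β M w zero
    alg : ∀ m v Q → (m ℤ.- v) ℤ.+ ((+ 1 ℤ.+ Q) ℤ.* v ℤ.+ (m ℤ.- v) ℤ.* Q) ≡ (+ 1 ℤ.+ Q) ℤ.* m
    alg = ZS.solve-∀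

  vertexCombination : ∀ (l : Fin (suc n) → ℚ) i →
    ∑ℚ (λ k → l k ℚ.* toℚ (simplexVerts q k i)) ≡ l zero ℚ.* ℚ.- toℚ (+ q i) ℚ.+ l (suc i)
  vertexCombination l i =
    cong₂ ℚ._+_ (cong (ℚ._*_ (l zero)) (toℚ-neg (+ q i))) (∑ℚ-select (λ k → l (suc k)) i)

  toℚ-∑-combination : ∀ w x (y : Fin n → ℚ) → (∀ i → toℚ (w i) ≡ x ℚ.* ℚ.- toℚ (+ q i) ℚ.+ y i) →
                      toℚ (∑ℤ w) ≡ x ℚ.* ℚ.- toℚ (+ ∑ℕ q) ℚ.+ ∑ℚ y
  toℚ-∑-combination w x y w≡ = begin
    toℚ (∑ℤ w)                                   ≡⟨ ∑ℚ-toℚ w ⟨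
    ∑ℚ (λ i → toℚ (w i))                         ≡⟨ ∑ℚ-cong w≡ ⟩
    ∑ℚ (λ i → x ℚ.* -q i ℚ.+ y i)                ≡⟨ ∑ℚ-distrib-+ (λ i → x ℚ.* -q i) y ⟩
    ∑ℚ (λ i → x ℚ.* -q i) ℚ.+ ∑ℚ y               ≡⟨ cong (ℚ._+ ∑ℚ y) (*-distribˡ-∑ℚ x -q) ⟩
    x ℚ.* ∑ℚ -q ℚ.+ ∑ℚ y                         ≡⟨ cong (λ s → x ℚ.* s ℚ.+ ∑ℚ y) ∑-q ⟩
    x ℚ.* ℚ.- toℚ (+ ∑ℕ q) ℚ.+ ∑ℚ y              ∎
    where
    open ≡-Reasoning
    -q : Fin n → ℚ
    -q i = ℚ.- toℚ (+ q i)
    ∑-q : ∑ℚ -q ≡ ℚ.- toℚ (+ ∑ℕ q)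
    ∑-q = begin
      ∑ℚ (λ i → ℚ.- toℚ (+ q i))   ≡⟨ ∑ℚ-cong (λ i → sym (toℚ-neg (+ q i))) ⟩
      ∑ℚ (λ i → toℚ (ℤ.- + q i))   ≡⟨ ∑ℚ-toℚ (λ i → ℤ.- + q i) ⟩
      toℚ (∑ℤ (λ i → ℤ.- + q i))   ≡⟨ cong toℚ (∑ℤ-neg-pos q) ⟩
      toℚ (ℤ.- + ∑ℕ q)             ≡⟨ toℚ-neg (+ ∑ℕ q) ⟩
      ℚ.- toℚ (+ ∑ℕ q)             ∎

  toℚ-N : toℚ (+ N) ≡ 1ℚ ℚ.+ toℚ (+ ∑ℕ q)
  toℚ-N = toℚ-+ (+ 1) (+ ∑ℕ q)

  β-barycentric : ∀ M w → ((l , _ , _) : InDilate (simplexVerts q) M w) →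
                  ∀ k → toℚ (β M w k) ≡ toℚ (+ N) ℚ.* l k
  β-barycentric M w (l , _ , ∑l≡M , l↦w) = β≡
    where
    L₀ = l zero
    L = ∑ℚ (λ i → l (suc i))
    Q = toℚ (+ ∑ℕ q)
    w≡ : ∀ i → toℚ (w i) ≡ L₀ ℚ.* ℚ.- toℚ (+ q i) ℚ.+ l (suc i)
    w≡ i = trans (sym (l↦w i)) (vertexCombination l i)
    ∑w≡ : toℚ (∑ℤ w) ≡ L₀ ℚ.* ℚ.- Q ℚ.+ L
    ∑w≡ = toℚ-∑-combination w L₀ (λ i → l (suc i)) w≡
    β≡ : ∀ k → toℚ (β M w k) ≡ toℚ (+ N) ℚ.* l k
    β≡ zero = begin
      toℚ (+ M ℤ.- ∑ℤ w)
        ≡⟨ trans (toℚ-+ (+ M) (ℤ.- ∑ℤ w)) (cong (ℚ._+_ (toℚ (+ M))) (toℚ-neg (∑ℤ w))) ⟩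
      toℚ (+ M) ℚ.- toℚ (∑ℤ w)
        ≡⟨ cong₂ ℚ._-_ (sym ∑l≡M) ∑w≡ ⟩
      (L₀ ℚ.+ L) ℚ.- (L₀ ℚ.* ℚ.- Q ℚ.+ L)
        ≡⟨ alg L₀ L Q ⟩
      (1ℚ ℚ.+ Q) ℚ.* L₀
        ≡⟨ cong (λ s → s ℚ.* L₀) toℚ-N ⟨
      toℚ (+ N) ℚ.* L₀ ∎
      where
      open ≡-Reasoning
      alg : ∀ x s Q → (x ℚ.+ s) ℚ.- (x ℚ.* ℚ.- Q ℚ.+ s) ≡ (1ℚ ℚ.+ Q) ℚ.* x
      alg = +-*-Solver.solve 3 (λ x s Q → (x :+ s) :- (x :* (:- Q) :+ s) := (con 1ℚ :+ Q) :* x) refl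
        where open +-*-Solver
    β≡ (suc i) = begin
      toℚ (+ N ℤ.* w i ℤ.+ β M w zero ℤ.* + q i)
        ≡⟨ trans (toℚ-+ (+ N ℤ.* w i) (β M w zero ℤ.* + q i))
                 (cong₂ ℚ._+_ (toℚ-* (+ N) (w i)) (toℚ-* (β M w zero) (+ q i))) ⟩
      toℚ (+ N) ℚ.* toℚ (w i) ℚ.+ toℚ (β M w zero) ℚ.* toℚ (+ q i)
        ≡⟨ cong₂ (λ x s → toℚ (+ N) ℚ.* x ℚ.+ s ℚ.* toℚ (+ q i)) (w≡ i) (β≡ zero) ⟩
      toℚ (+ N) ℚ.* (L₀ ℚ.* ℚ.- toℚ (+ q i) ℚ.+ l (suc i)) ℚ.+ toℚ (+ N) ℚ.* L₀ ℚ.* toℚ (+ q i)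
        ≡⟨ alg (toℚ (+ N)) L₀ (toℚ (+ q i)) (l (suc i)) ⟩
      toℚ (+ N) ℚ.* l (suc i) ∎
      where
      open ≡-Reasoning
      alg : ∀ a x b y → a ℚ.* (x ℚ.* ℚ.- b ℚ.+ y) ℚ.+ a ℚ.* x ℚ.* b ≡ a ℚ.* y
      alg = +-*-Solver.solve 4 (λ a x b y → a :* (x :* (:- b) :+ y) :+ a :* x :* b := a :* y) refl
        where open +-*-Solver

  inDilate⇒InΔ : ∀ M w → InDilate (simplexVerts q) M w → InΔ M w
  inDilate⇒InΔ M w w∈@(l , l≥0 , _) k = toℚ-cancel-≤ (subst (ℚ._≤_ 0ℚ) (sym (β-barycentric M w w∈ k))
    (*-nonNeg (toℚ-mono-≤ {+0} {+ N} (ℤ.+≤+ z≤n)) (l≥0 k)))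

  -- N as a normalised rational literal, for which ℚ.1/ finds the NonZero instance.
  private
    N′ : ℚ
    N′ = ℚ.mkℚ (+ N) 0 (Coprime.sym (Coprime.1-coprimeTo N))

    toℚ-N≡N′ : toℚ (+ N) ≡ N′
    toℚ-N≡N′ = ℚP.↥p/↧p≡p N′

    N*1/N : toℚ (+ N) ℚ.* ℚ.1/ N′ ≡ 1ℚ
    N*1/N = trans (cong (λ x → x ℚ.* ℚ.1/ N′) toℚ-N≡N′) (ℚP.*-inverseʳ N′)

    1/N≥0 : 0ℚ ℚ.≤ ℚ.1/ N′
    1/N≥0 = ℚP.nonNegative⁻¹ (ℚ.1/ N′) {{ℚP.pos⇒nonNeg (ℚ.1/ N′) {{ℚP.1/pos⇒pos N′}}}}

    1/N*[N*x]≡x : ∀ x → ℚ.1/ N′ ℚ.* (toℚ (+ N) ℚ.* x) ≡ x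
    1/N*[N*x]≡x x =
      trans (alg (ℚ.1/ N′) (toℚ (+ N)) x) (trans (cong (ℚ._* x) N*1/N) (ℚP.*-identityˡ x))
      where
      alg : ∀ u a x → u ℚ.* (a ℚ.* x) ≡ (a ℚ.* u) ℚ.* x
      alg = +-*-Solver.solve 3 (λ u a x → u :* (a :* x) := (a :* u) :* x) refl
        where open +-*-Solver

  InΔ⇒inDilate : ∀ M w → InΔ M w → InDilate (simplexVerts q) M w
  InΔ⇒inDilate M w w∈ = l , l≥0 , ∑l≡M , l↦w
    where
    u = ℚ.1/ N′
    l : Fin (suc n) → ℚ
    l k = u ℚ.* toℚ (β M w k)
    l≥0 : ∀ k → 0ℚ ℚ.≤ l k
    l≥0 k = *-nonNeg 1/N≥0 (toℚ-mono-≤ (w∈ k))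
    ∑l≡M : ∑ℚ l ≡ toℚ (+ M)
    ∑l≡M = begin
      l zero ℚ.+ ∑ℚ (λ i → u ℚ.* toℚ (β M w (suc i)))
        ≡⟨ cong (ℚ._+_ (l zero)) (trans (*-distribˡ-∑ℚ u (λ i → toℚ (β M w (suc i))))
                                        (cong (ℚ._*_ u) (∑ℚ-toℚ (λ i → β M w (suc i))))) ⟩
      u ℚ.* toℚ (β M w zero) ℚ.+ u ℚ.* toℚ (∑ℤ (λ i → β M w (suc i)))
        ≡⟨ trans (sym (ℚP.*-distribˡ-+ u (toℚ (β M w zero)) _))
                 (cong (ℚ._*_ u) (sym (toℚ-+ (β M w zero) _))) ⟩
      u ℚ.* toℚ (β M w zero ℤ.+ ∑ℤ (λ i → β M w (suc i)))
        ≡⟨ cong (λ z → u ℚ.* toℚ z) (∑β M w) ⟩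
      u ℚ.* toℚ (+ N ℤ.* + M)
        ≡⟨ trans (cong (ℚ._*_ u) (toℚ-* (+ N) (+ M))) (1/N*[N*x]≡x (toℚ (+ M))) ⟩
      toℚ (+ M) ∎
      where open ≡-Reasoning
    l↦w : ∀ i → ∑ℚ (λ k → l k ℚ.* toℚ (simplexVerts q k i)) ≡ toℚ (w i)
    l↦w i = begin
      ∑ℚ (λ k → l k ℚ.* toℚ (simplexVerts q k i))
        ≡⟨ vertexCombination l i ⟩
      u ℚ.* s ℚ.* ℚ.- toℚ (+ q i) ℚ.+ u ℚ.* toℚ (+ N ℤ.* w i ℤ.+ β M w zero ℤ.* + q i)
        ≡⟨ cong (λ z → u ℚ.* s ℚ.* ℚ.- toℚ (+ q i) ℚ.+ u ℚ.* z)
                (trans (toℚ-+ (+ N ℤ.* w i) (β M w zero ℤ.* + q i))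
                       (cong₂ ℚ._+_ (toℚ-* (+ N) (w i)) (toℚ-* (β M w zero) (+ q i)))) ⟩
      u ℚ.* s ℚ.* ℚ.- toℚ (+ q i) ℚ.+ u ℚ.* (toℚ (+ N) ℚ.* toℚ (w i) ℚ.+ s ℚ.* toℚ (+ q i))
        ≡⟨ alg u s (toℚ (+ q i)) (toℚ (+ N) ℚ.* toℚ (w i)) ⟩
      u ℚ.* (toℚ (+ N) ℚ.* toℚ (w i))
        ≡⟨ 1/N*[N*x]≡x (toℚ (w i)) ⟩
      toℚ (w i) ∎
      where
      open ≡-Reasoning
      s = toℚ (β M w zero)
      alg : ∀ u s b y → u ℚ.* s ℚ.* ℚ.- b ℚ.+ u ℚ.* (y ℚ.+ s ℚ.* b) ≡ u ℚ.* y
      alg = +-*-Solver.solve 4 (λ u s b y → u :* s :* (:- b) :+ u :* (y :+ s :* b) := u :* y) refl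
        where open +-*-Solver

  β₀≡0⇒M≡0 : ∀ {M w} → InΔ M w → β M w zero ≡ +0 → (∀ i → β M w (suc i) ℤ.< + N) → M ≡ 0
  β₀≡0⇒M≡0 {M} {w} w∈ β₀≡0 βi<N = ℤP.+-injective (begin
    + M                  ≡⟨ ℤP.+-identityʳ (+ M) ⟨
    + M ℤ.- +0           ≡⟨ cong (λ s → + M ℤ.- s) (trans (sym (∑ℤ-zero {n})) (∑ℤ-cong (sym ∘ w≡0))) ⟩
    β M w zero           ≡⟨ β₀≡0 ⟩
    +0                   ∎)
    where
    open ≡-Reasoning
    βi≡Nw : ∀ i → β M w (suc i) ≡ + N ℤ.* w i ℤ.+ + 0
    βi≡Nw i = cong (λ s → + N ℤ.* w i ℤ.+ s ℤ.* + q i) β₀≡0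
    w≡0 : ∀ i → w i ≡ +0
    w≡0 i = floor-unique N 0 (w i) (subst (ℤ._≤_ +0) (βi≡Nw i) (w∈ (suc i)))
                                   (subst (ℤ._< + N) (βi≡Nw i) (βi<N i))

  Decomposition : ℕ → (Fin n → ℤ) → Set
  Decomposition m w =
    Σ (Fin m → Fin n → ℤ) λ X → (∀ t → InΔ 1 (X t)) × (∀ i → ∑ℤ (λ t → X t i) ≡ w i)

  Peelable : ℕ → (Fin n → ℤ) → Set
  Peelable M w = ∃ λ x → InΔ 1 x × InΔ M (λ i → w i ℤ.- x i)

  peel : ∀ {M w} x → (∀ k → β 1 x k ℤ.≤ β (suc M) w k) → InΔ M (λ i → w i ℤ.- x i)
  peel {M} {w} x βx≤βw k =
    subst (ℤ._≤_ +0) ([a+b]-a≡b (β 1 x k) _) (ℤP.i≤j⇒0≤j-i (subst (β 1 x k ℤ.≤_) βw≡ (βx≤βw k)))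
    where
    βw≡ : β (suc M) w k ≡ β 1 x k ℤ.+ β M (λ i → w i ℤ.- x i) k
    βw≡ = trans (β-cong (suc M) (λ i → sym (a+[b-a]≡b (x i) (w i))) k) (β-+ 1 M x (λ i → w i ℤ.- x i) k)

  peel-vertex : ∀ {M w} k → + N ℤ.≤ β (suc M) w k → InΔ (suc M) w → Peelable M w
  peel-vertex {M} {w} k N≤βk w∈ = simplexVerts q k , InΔ-vertex k , peel (simplexVerts q k) vertex≤w
    where
    Ne≤β : ∀ k′ → + N ℤ.* e k k′ ℤ.≤ β (suc M) w k′
    Ne≤β k′ with k ≟ k′
    ... | yes refl = subst (ℤ._≤ β (suc M) w k) (sym (ℤP.*-identityʳ (+ N))) N≤βk
    ... | no  _    = subst (ℤ._≤ β (suc M) w k′) (sym (ℤP.*-zeroʳ (+ N))) (w∈ k′)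
    vertex≤w : ∀ k′ → β 1 (simplexVerts q k) k′ ℤ.≤ β (suc M) w k′
    vertex≤w k′ = subst (ℤ._≤ β (suc M) w k′) (sym (β-vertex k k′)) (Ne≤β k′)

  decompose : (∀ m w → InΔ (2 + m) w → Peelable (suc m) w) →
              ∀ m w → InΔ (suc m) w → Decomposition (suc m) w
  decompose peelable zero    w w∈ = (λ _ → w) , (λ _ → w∈) , (λ i → ℤP.+-identityʳ (w i))
  decompose peelable (suc m) w w∈
    with x , x∈ , r∈ ← peelable m w w∈
    with X , X∈ , ∑X≡r ← decompose peelable m (λ i → w i ℤ.- x i) r∈
    = (λ { zero → x ; (suc t) → X t }) , (λ { zero → x∈ ; (suc t) → X∈ t }) ,
      λ i → trans (cong (ℤ._+_ (x i)) (∑X≡r i)) (a+[b-a]≡b (x i) (w i))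

  decomposable⇒IDP : (∀ m w → InΔ (suc m) w → Decomposition (suc m) w) → IDP (simplexVerts q)
  decomposable⇒IDP decomposable (suc m) _ w w∈
    with X , X∈ , ∑X≡w ← decomposable m w (inDilate⇒InΔ (suc m) w w∈)
    = X , (λ t → InΔ⇒inDilate 1 (X t) (X∈ t)) , ∑X≡w

module Face {n : ℕ} {q : Fin n → ℕ} (q≥1 : ∀ i → 1 ≤ q i) (q∣ : ∀ j → q j ∣ suc (∑≠ j q)) where
  open Barycentric q

  instance
    q-nonZero : ∀ {i} → NonZero (q i)
    q-nonZero {i} = ℕ.>-nonZero (q≥1 i)

  K′ : Fin n → ℕ
  K′ j = (1 + ∑≠ j q) div q j

  K : Fin n → ℕ
  K j = suc (K′ j)

  K*q≡N : ∀ j → K j * q j ≡ N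
  K*q≡N j = begin
    q j + K′ j * q j             ≡⟨ cong (λ k → q j + k * q j) (div≡/ (1 + ∑≠ j q) (q j)) ⟩
    q j + (1 + ∑≠ j q) / q j * q j ≡⟨ cong (λ k → q j + k) (m/n*n≡m (q∣ j)) ⟩
    q j + suc (∑≠ j q)            ≡⟨ ℕP.+-suc (q j) (∑≠ j q) ⟩
    suc (q j + ∑≠ j q)            ≡⟨ cong suc (∑≠-split j q) ⟨
    N                             ∎
    where open ≡-Reasoning

  fl : Fin n → ℕ → Fin n → ℕ
  fl j c i = (c * q i) div q j

  fl-diag : ∀ j c → fl j c j ≡ c
  fl-diag j c = trans (div≡/ (c * q j) (q j)) (m*n/n≡m c (q j))

  facePoint : Fin n → ℕ → Fin n → ℤ
  facePoint j c i = ℤ.- + fl j c i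

  -- The paper's c (1 + Σ_{i≠j} q_i) / q_j - Σ_{i≠j} ⌊c q_i / q_j⌋ equals M.
  Height : Fin n → ℕ → ℕ → Set
  Height j c M = ∑≠ j (fl j c) + M ≡ c * K′ j

  Height⇔ : ∀ j c M → (Height j c M → M + ∑ℕ (fl j c) ≡ K j * c) ×
                      (M + ∑ℕ (fl j c) ≡ K j * c → Height j c M)
  Height⇔ j c M = (λ ht → trans lhs (trans (cong (_+_ c) ht) rhs)) ,
                  (λ eq → ℕP.+-cancelˡ-≡ c _ _ (trans (sym lhs) (trans eq (sym rhs))))
    where
    lhs : M + ∑ℕ (fl j c) ≡ c + (∑≠ j (fl j c) + M)
    lhs = begin
      M + ∑ℕ (fl j c)                  ≡⟨ cong (_+_ M) (∑≠-split j (fl j c)) ⟩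
      M + (fl j c j + ∑≠ j (fl j c))   ≡⟨ cong (λ x → M + (x + ∑≠ j (fl j c))) (fl-diag j c) ⟩
      M + (c + ∑≠ j (fl j c))          ≡⟨ alg M c (∑≠ j (fl j c)) ⟩
      c + (∑≠ j (fl j c) + M)          ∎
      where
      open ≡-Reasoning
      alg : ∀ M c S → M + (c + S) ≡ c + (S + M)
      alg = NS.solve-∀
    rhs : c + c * K′ j ≡ K j * c
    rhs = cong (_+_ c) (ℕP.*-comm c (K′ j))

  +N≡K*q : ∀ j → + N ≡ + K j ℤ.* + q j
  +N≡K*q j = trans (cong +_ (sym (K*q≡N j))) (ℤP.pos-* (K j) (q j))

  β₀-facePoint : ∀ j c M → β M (facePoint j c) zero ≡ + (M + ∑ℕ (fl j c))
  β₀-facePoint j c M = begin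
    + M ℤ.- ∑ℤ (facePoint j c)          ≡⟨ cong (λ s → + M ℤ.- s) (∑ℤ-neg-pos (fl j c)) ⟩
    + M ℤ.- ℤ.- + ∑ℕ (fl j c)           ≡⟨ cong (ℤ._+_ (+ M)) (ℤP.neg-involutive (+ ∑ℕ (fl j c))) ⟩
    + M ℤ.+ + ∑ℕ (fl j c)               ≡⟨ ℤP.pos-+ M (∑ℕ (fl j c)) ⟨
    + (M + ∑ℕ (fl j c))                 ∎
    where open ≡-Reasoning

  Height⇒β₀ : ∀ {j} c {M} → Height j c M → β M (facePoint j c) zero ≡ + (K j * c)
  Height⇒β₀ {j} c {M} ht = trans (β₀-facePoint j c M) (cong +_ (proj₁ (Height⇔ j c M) ht))

  Height⇒β : ∀ {j} c {M} → Height j c M → ∀ i → β M (facePoint j c) (suc i) ≡ + (K j * (c * q i % q j))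
  Height⇒β {j} c {M} ht i = begin
    + N ℤ.* ℤ.- + f ℤ.+ β M (facePoint j c) zero ℤ.* + q i
      ≡⟨ cong₂ (λ a s → a ℤ.* ℤ.- + f ℤ.+ s ℤ.* + q i) (+N≡K*q j)
               (trans (Height⇒β₀ c ht) (ℤP.pos-* (K j) c)) ⟩
    + K j ℤ.* + q j ℤ.* ℤ.- + f ℤ.+ + K j ℤ.* + c ℤ.* + q i
      ≡⟨ cong (λ a → + K j ℤ.* + q j ℤ.* ℤ.- + f ℤ.+ a)
              (trans (ℤP.*-assoc (+ K j) (+ c) (+ q i)) (cong (ℤ._*_ (+ K j)) cq≡r+fq)) ⟩
    + K j ℤ.* + q j ℤ.* ℤ.- + f ℤ.+ + K j ℤ.* (+ r ℤ.+ + f ℤ.* + q j)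
      ≡⟨ alg (+ K j) (+ q j) (+ f) (+ r) ⟩
    + K j ℤ.* + r
      ≡⟨ ℤP.pos-* (K j) r ⟨
    + (K j * r) ∎
    where
    open ≡-Reasoning
    f = fl j c i
    r = c * q i % q j
    cq≡r+fq : + c ℤ.* + q i ≡ + r ℤ.+ + f ℤ.* + q j
    cq≡r+fq = begin
      + c ℤ.* + q i               ≡⟨ ℤP.pos-* c (q i) ⟨
      + (c * q i)                 ≡⟨ cong +_ (m≡m%n+[m/n]*n (c * q i) (q j)) ⟩
      + (r + c * q i / q j * q j) ≡⟨ cong (λ x → + (r + x * q j)) (div≡/ (c * q i) (q j)) ⟨
      + (r + f * q j)             ≡⟨ trans (ℤP.pos-+ r (f * q j)) (cong (ℤ._+_ (+ r)) (ℤP.pos-* f (q j))) ⟩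
      + r ℤ.+ + f ℤ.* + q j       ∎
    alg : ∀ k Q f r → k ℤ.* Q ℤ.* ℤ.- f ℤ.+ k ℤ.* (r ℤ.+ f ℤ.* Q) ≡ k ℤ.* r
    alg = ZS.solve-∀

  -- x ∈ M·Δ lies on the facet opposite e j, and no x - e i lies in (M - 1)·Δ.
  Facet : Fin n → ℕ → (Fin n → ℤ) → Set
  Facet j M x = InΔ M x × β M x (suc j) ≡ +0 × (∀ i → β M x (suc i) ℤ.< + N)

  facePoint∈Facet : ∀ {j} c {M} → Height j c M → Facet j M (facePoint j c)
  facePoint∈Facet {j} c {M} ht = x∈ , βj≡0 , βi<N
    where
    x∈ : InΔ M (facePoint j c)
    x∈ zero    = subst (ℤ._≤_ +0) (sym (Height⇒β₀ c ht)) (ℤ.+≤+ z≤n)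
    x∈ (suc i) = subst (ℤ._≤_ +0) (sym (Height⇒β c ht i)) (ℤ.+≤+ z≤n)
    βj≡0 : β M (facePoint j c) (suc j) ≡ +0
    βj≡0 = trans (Height⇒β c ht j) (cong +_ (trans (cong (_*_ (K j)) (m*n%n≡0 c (q j))) (ℕP.*-zeroʳ (K j))))
    βi<N : ∀ i → β M (facePoint j c) (suc i) ℤ.< + N
    βi<N i = subst₂ ℤ._<_ (sym (Height⇒β c ht i)) (cong +_ (K*q≡N j))
                   (ℤ.+<+ (ℕP.*-monoʳ-< (K j) (m%n<n (c * q i) (q j))))

  βj≡0⇒Kx+β₀≡0 : ∀ {j M x} → β M x (suc j) ≡ +0 → + K j ℤ.* x j ℤ.+ β M x zero ≡ +0
  βj≡0⇒Kx+β₀≡0 {j} {M} {x} βj≡0 = ℤP.*-cancelˡ-≡ (+ q j) _ _ (begin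
    + q j ℤ.* (+ K j ℤ.* x j ℤ.+ s)           ≡⟨ alg (+ q j) (+ K j) (x j) s ⟩
    + K j ℤ.* + q j ℤ.* x j ℤ.+ s ℤ.* + q j   ≡⟨ cong (λ a → a ℤ.* x j ℤ.+ s ℤ.* + q j) (+N≡K*q j) ⟨
    β M x (suc j)                             ≡⟨ βj≡0 ⟩
    +0                                        ≡⟨ ℤP.*-zeroʳ (+ q j) ⟨
    + q j ℤ.* +0                              ∎)
    where
    open ≡-Reasoning
    s = β M x zero
    alg : ∀ Q k y s → Q ℤ.* (k ℤ.* y ℤ.+ s) ≡ k ℤ.* Q ℤ.* y ℤ.+ s ℤ.* Q
    alg = ZS.solve-∀

  Facet⇒facePoint : ∀ {j M x} → Facet j M x → ∃ λ c → (∀ i → x i ≡ facePoint j c i) × Height j c M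
  Facet⇒facePoint {j} {M} {x} (x∈ , βj≡0 , βi<N) = c , x≡ , ht
    where
    s = β M x zero
    solution = k*y+s≡0⇒y≡-c (K′ j) (x j) (x∈ zero) (βj≡0⇒Kx+β₀≡0 {j} {M} {x} βj≡0)
    c = proj₁ solution
    s≡Kc : s ≡ + (K j * c)
    s≡Kc = proj₂ (proj₂ solution)
    βi≡ : ∀ i → β M x (suc i) ≡ + K j ℤ.* (+ q j ℤ.* x i ℤ.+ + (c * q i))
    βi≡ i = begin
      + N ℤ.* x i ℤ.+ s ℤ.* + q i
        ≡⟨ cong₂ (λ a b → a ℤ.* x i ℤ.+ b ℤ.* + q i) (+N≡K*q j) (trans s≡Kc (ℤP.pos-* (K j) c)) ⟩
      + K j ℤ.* + q j ℤ.* x i ℤ.+ + K j ℤ.* + c ℤ.* + q i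
        ≡⟨ alg (+ K j) (+ q j) (x i) (+ c) (+ q i) ⟩
      + K j ℤ.* (+ q j ℤ.* x i ℤ.+ + c ℤ.* + q i)
        ≡⟨ cong (λ a → + K j ℤ.* (+ q j ℤ.* x i ℤ.+ a)) (ℤP.pos-* c (q i)) ⟨
      + K j ℤ.* (+ q j ℤ.* x i ℤ.+ + (c * q i)) ∎
      where
      open ≡-Reasoning
      alg : ∀ k Q y c b → k ℤ.* Q ℤ.* y ℤ.+ k ℤ.* c ℤ.* b ≡ k ℤ.* (Q ℤ.* y ℤ.+ c ℤ.* b)
      alg = ZS.solve-∀
    x≡ : ∀ i → x i ≡ facePoint j c i
    x≡ i = trans (floor-unique (q j) (c * q i) (x i) 0≤T T<q) (cong (λ f → ℤ.- + f) (sym (div≡/ (c * q i) (q j))))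
      where
      0≤T = ℤP.*-cancelˡ-≤-pos +0 _ (+ K j)
              (subst₂ ℤ._≤_ (sym (ℤP.*-zeroʳ (+ K j))) (βi≡ i) (x∈ (suc i)))
      T<q = ℤP.*-cancelˡ-<-nonNeg (+ K j) (subst₂ ℤ._<_ (βi≡ i) (+N≡K*q j) (βi<N i))
    ht : Height j c M
    ht = proj₂ (Height⇔ j c M) (ℤP.+-injective (begin
      + (M + ∑ℕ (fl j c))             ≡⟨ β₀-facePoint j c M ⟨
      β M (facePoint j c) zero        ≡⟨ β-cong M x≡ zero ⟨
      s                               ≡⟨ s≡Kc ⟩
      + (K j * c)                     ∎))
      where open ≡-Reasoning

  Height⇒1≤c : ∀ j c M → Height j c (suc M) → 1 ≤ c
  Height⇒1≤c j zero    M ht with () ← trans (sym (ℕP.+-suc (∑≠ j (fl j 0)) M)) ht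
  Height⇒1≤c j (suc c) M _ = s≤s z≤n

  facePoint-+ : ∀ j b c d → (∀ i → fl j b i ≡ fl j c i + fl j d i) →
                ∀ i → facePoint j c i ℤ.+ facePoint j d i ≡ facePoint j b i
  facePoint-+ j b c d fl≡ i = trans (neg-pos-+ (fl j c i) (fl j d i)) (cong (λ f → ℤ.- + f) (sym (fl≡ i)))

  facePoint-+⁻¹ : ∀ j b c d → (∀ i → facePoint j c i ℤ.+ facePoint j d i ≡ facePoint j b i) →
                  ∀ i → fl j b i ≡ fl j c i + fl j d i
  facePoint-+⁻¹ j b c d fp≡ i =
    ℤP.+-injective (ℤP.neg-injective (trans (sym (fp≡ i)) (neg-pos-+ (fl j c i) (fl j d i))))

  Facet-cong : ∀ {j M} {w w′ : Fin n → ℤ} → (∀ i → w i ≡ w′ i) → Facet j M w → Facet j M w′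
  Facet-cong {j} {M} w≗w′ (w∈ , βj≡0 , βi<N) =
    InΔ-cong M w≗w′ w∈ , trans (sym (β-cong M w≗w′ (suc j))) βj≡0 ,
    λ i → subst (ℤ._< + N) (β-cong M w≗w′ (suc i)) (βi<N i)

  Facet-split : ∀ {j M M′} {x r : Fin n → ℤ} → InΔ M x → InΔ M′ r →
                Facet j (M + M′) (λ i → x i ℤ.+ r i) → Facet j M x × Facet j M′ r
  Facet-split {j} {M} {M′} {x} {r} x∈ r∈ (_ , βj≡0 , βi<N) =
    (x∈ , ℤP.≤-antisym (subst (βx (suc j) ℤ.≤_) βj≡0′ (x≤x+r (suc j))) (x∈ (suc j)) ,
          λ i → ℤP.≤-<-trans (x≤x+r (suc i)) (βi<N′ i)) ,
    (r∈ , ℤP.≤-antisym (subst (βr (suc j) ℤ.≤_) βj≡0′ (r≤x+r (suc j))) (r∈ (suc j)) ,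
          λ i → ℤP.≤-<-trans (r≤x+r (suc i)) (βi<N′ i))
    where
    βx = β M x
    βr = β M′ r
    x≤x+r : ∀ k → βx k ℤ.≤ βx k ℤ.+ βr k
    x≤x+r k = ℤP.i≤i+j (βx k) (βr k) {{ℤ.nonNegative (r∈ k)}}
    r≤x+r : ∀ k → βr k ℤ.≤ βx k ℤ.+ βr k
    r≤x+r k = ℤP.i≤j+i (βr k) (βx k) {{ℤ.nonNegative (x∈ k)}}
    βj≡0′ : βx (suc j) ℤ.+ βr (suc j) ≡ +0
    βj≡0′ = trans (sym (β-+ M M′ x r (suc j))) βj≡0
    βi<N′ : ∀ i → βx (suc i) ℤ.+ βr (suc i) ℤ.< + N
    βi<N′ i = subst (ℤ._< + N) (β-+ M M′ x r (suc i)) (βi<N i)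

  -- Cond q unfolds to ∀ j b → 1 ≤ b → b < q j → ∑≠ j (fl j b) + 2 ≤ b * K′ j → Splits j b.
  Splits : Fin n → ℕ → Set
  Splits j b = Σ ℕ λ c → (1 ≤ c) × (c < b) ×
    (∀ i → ¬ i ≡ j → fl j b i ≡ fl j c i + fl j (b ∸ c) i) × (c * K′ j ≡ ∑≠ j (fl j c) + 1)

  splits : ∀ j b c c′ M → Height j c 1 → Height j c′ (suc M) →
           (∀ i → fl j b i ≡ fl j c i + fl j c′ i) → Splits j b
  splits j b c c′ M ht ht′ fl≡ = c , Height⇒1≤c j c 0 ht , c<b , fl≡′ , sym ht
    where
    b≡c+c′ : b ≡ c + c′
    b≡c+c′ = trans (sym (fl-diag j b)) (trans (fl≡ j) (cong₂ _+_ (fl-diag j c) (fl-diag j c′)))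
    c<b : c < b
    c<b = subst (c <_) (sym b≡c+c′) (ℕP.m<m+n c (Height⇒1≤c j c′ M ht′))
    fl≡′ : ∀ i → ¬ i ≡ j → fl j b i ≡ fl j c i + fl j (b ∸ c) i
    fl≡′ i _ = trans (fl≡ i) (cong (λ d → fl j c i + fl j d i)
                                   (sym (trans (cong (_∸ c) b≡c+c′) (ℕP.m+n∸m≡n c c′))))

  gap⇒Height : ∀ j b → ∑≠ j (fl j b) + 2 ≤ b * K′ j → ∃ λ M → Height j b (2 + M)
  gap⇒Height j b gap = b * K′ j ∸ (S + 2) , trans (sym (ℕP.+-assoc S 2 _)) (ℕP.m+[n∸m]≡n gap)
    where S = ∑≠ j (fl j b)

  sum⇒Splits : ∀ j b M {x r : Fin n → ℤ} → Height j b (2 + M) → InΔ 1 x → InΔ (suc M) r →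
               (∀ i → x i ℤ.+ r i ≡ facePoint j b i) → Splits j b
  sum⇒Splits j b M {x} {r} ht x∈ r∈ x+r≡w = splits j b c c′ M ht-c ht-c′ fl≡
    where
    facets = Facet-split x∈ r∈ (Facet-cong (λ i → sym (x+r≡w i)) (facePoint∈Facet b ht))
    x-face = Facet⇒facePoint (proj₁ facets)
    r-face = Facet⇒facePoint (proj₂ facets)
    c = proj₁ x-face
    c′ = proj₁ r-face
    ht-c : Height j c 1
    ht-c = proj₂ (proj₂ x-face)
    ht-c′ : Height j c′ (suc M)
    ht-c′ = proj₂ (proj₂ r-face)
    fl≡ : ∀ i → fl j b i ≡ fl j c i + fl j c′ i
    fl≡ = facePoint-+⁻¹ j b c c′ (λ i →
      trans (cong₂ ℤ._+_ (sym (proj₁ (proj₂ x-face) i)) (sym (proj₁ (proj₂ r-face) i))) (x+r≡w i))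

  IDP⇒Cond : IDP (simplexVerts q) → Cond q
  IDP⇒Cond idp j b _ _ gap = sum⇒Splits j b M ht x∈ r∈ ∑X≡w
    where
    M = proj₁ (gap⇒Height j b gap)
    ht = proj₂ (gap⇒Height j b gap)
    decomposition = idp (2 + M) (s≤s z≤n) (facePoint j b) (InΔ⇒inDilate _ _ (proj₁ (facePoint∈Facet b ht)))
    X = proj₁ decomposition
    x∈ : InΔ 1 (X zero)
    x∈ = inDilate⇒InΔ 1 (X zero) (proj₁ (proj₂ decomposition) zero)
    r∈ : InΔ (suc M) (λ i → ∑ℤ (λ t → X (suc t) i))
    r∈ = InΔ-∑ (suc M) (λ t → X (suc t))
                       (λ t → inDilate⇒InΔ 1 (X (suc t)) (proj₁ (proj₂ decomposition) (suc t)))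
    ∑X≡w = proj₂ (proj₂ decomposition)

  peel-origin : ∀ {M w} → InΔ (suc M) w → (∀ k → β (suc M) w k ℤ.< + N) →
                (∀ i → ¬ β (suc M) w (suc i) ≡ +0) → Peelable M w
  peel-origin {M} {w} w∈ β<N βi≢0 = (λ _ → +0) , InΔ-origin 1 , peel (λ _ → +0) origin≤w
    where
    s = β (suc M) w zero
    origin≤w : ∀ k → β 1 (λ _ → +0) k ℤ.≤ β (suc M) w k
    origin≤w zero = subst (ℤ._≤ s) (sym (β-origin₀ 1)) (ℤP.i<j⇒suc[i]≤j (ℤP.≤∧≢⇒< (w∈ zero) s≢0))
      where
      s≢0 : ¬ +0 ≡ s
      s≢0 0≡s = ℕP.1+n≢0 (β₀≡0⇒M≡0 w∈ (sym 0≡s) (λ i → β<N (suc i)))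
    origin≤w (suc i) = subst₂ ℤ._≤_ (sym (trans (β-origin 1 i) (cong +_ (ℕP.*-identityˡ (q i))))) (sym βi≡)
      (0<a*y⇒a≤a*y (q i) _ (subst (ℤ._<_ +0) βi≡ (ℤP.≤∧≢⇒< (w∈ (suc i)) (βi≢0 i ∘ sym))))
      where
      βi≡ : β (suc M) w (suc i) ≡ + q i ℤ.* (+ K i ℤ.* w i ℤ.+ s)
      βi≡ = trans (cong (λ a → a ℤ.* w i ℤ.+ s ℤ.* + q i) (+N≡K*q i)) (alg (+ K i) (+ q i) (w i) s)
        where
        alg : ∀ k Q y s → k ℤ.* Q ℤ.* y ℤ.+ s ℤ.* Q ≡ Q ℤ.* (k ℤ.* y ℤ.+ s)
        alg = ZS.solve-∀

  Height⇒gap : ∀ j b m → Height j b (2 + m) → ∑≠ j (fl j b) + 2 ≤ b * K′ j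
  Height⇒gap j b m ht = subst (∑≠ j (fl j b) + 2 ≤_) ht (ℕP.+-monoʳ-≤ (∑≠ j (fl j b)) (s≤s (s≤s z≤n)))

  Height-∸ : ∀ j b c m → Height j b (2 + m) → Height j c 1 → c < b →
            (∀ i → ¬ i ≡ j → fl j b i ≡ fl j c i + fl j (b ∸ c) i) → Height j (b ∸ c) (suc m)
  Height-∸ j b c m ht-b ht-c c<b fl≡ = ℕP.+-cancelˡ-≡ (Sc + 1) _ _ (begin
    Sc + 1 + (Sd + suc m)    ≡⟨ alg Sc Sd m ⟩
    Sc + Sd + (2 + m)        ≡⟨ cong (λ S → S + (2 + m)) (∑≠-additive j (fl j b) (fl j c) (fl j d) fl≡) ⟨
    Sb + (2 + m)             ≡⟨ ht-b ⟩
    b * K′ j                 ≡⟨ cong (_* K′ j) (ℕP.m+[n∸m]≡n (ℕP.<⇒≤ c<b)) ⟨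
    (c + d) * K′ j           ≡⟨ ℕP.*-distribʳ-+ (K′ j) c d ⟩
    c * K′ j + d * K′ j      ≡⟨ cong (_+ d * K′ j) ht-c ⟨
    Sc + 1 + d * K′ j        ∎)
    where
    open ≡-Reasoning
    d = b ∸ c
    Sb = ∑≠ j (fl j b)
    Sc = ∑≠ j (fl j c)
    Sd = ∑≠ j (fl j d)
    alg : ∀ a b m → a + 1 + (b + suc m) ≡ a + b + (2 + m)
    alg = NS.solve-∀

  facePoint-b<q : ∀ {j b M} → Height j b M → β M (facePoint j b) zero ℤ.< + N → b < q j
  facePoint-b<q {j} {b} ht β₀<N = ℕP.*-cancelˡ-< (K j) b (q j)
    (ℤP.drop‿+<+ (subst₂ ℤ._<_ (Height⇒β₀ b ht) (cong +_ (sym (K*q≡N j))) β₀<N))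

  module _ (cond : Cond q) where

    peel-facePoint : ∀ {j m w} b → (∀ i → w i ≡ facePoint j b i) → Height j b (2 + m) → b < q j →
                     Peelable (suc m) w
    peel-facePoint {j} {m} {w} b w≡ ht-b b<q =
      facePoint j c , proj₁ (facePoint∈Facet c ht-c) , InΔ-cong (suc m) r≡ (proj₁ (facePoint∈Facet d ht-d))
      where
      split = cond j b (Height⇒1≤c j b (suc m) ht-b) b<q (Height⇒gap j b m ht-b)
      c = proj₁ split
      c<b : c < b
      c<b = proj₁ (proj₂ (proj₂ split))
      fl≡ : ∀ i → ¬ i ≡ j → fl j b i ≡ fl j c i + fl j (b ∸ c) i
      fl≡ = proj₁ (proj₂ (proj₂ (proj₂ split)))
      ht-c : Height j c 1
      ht-c = sym (proj₂ (proj₂ (proj₂ (proj₂ split))))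
      d = b ∸ c
      ht-d : Height j d (suc m)
      ht-d = Height-∸ j b c m ht-b ht-c c<b fl≡
      fl-all : ∀ i → fl j b i ≡ fl j c i + fl j d i
      fl-all i with i ≟ j
      ... | yes refl = trans (fl-diag j b) (trans (sym (ℕP.m+[n∸m]≡n (ℕP.<⇒≤ c<b)))
                                                  (sym (cong₂ _+_ (fl-diag j c) (fl-diag j d))))
      ... | no  i≢j  = fl≡ i i≢j
      r≡ : ∀ i → facePoint j d i ≡ w i ℤ.- facePoint j c i
      r≡ i = trans (sym ([a+b]-a≡b (facePoint j c i) (facePoint j d i)))
                   (cong (λ v → v ℤ.- facePoint j c i) (trans (facePoint-+ j b c d fl-all i) (sym (w≡ i))))

    peel-facet : ∀ {j m w} → Facet j (2 + m) w → β (2 + m) w zero ℤ.< + N → Peelable (suc m) w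
    peel-facet {m = m} {w} facet β₀<N =
      peel-facePoint b w≡ ht-b (facePoint-b<q ht-b (subst (ℤ._< + N) (β-cong (2 + m) w≡ zero) β₀<N))
      where
      b = proj₁ (Facet⇒facePoint facet)
      w≡ = proj₁ (proj₂ (Facet⇒facePoint facet))
      ht-b = proj₂ (proj₂ (Facet⇒facePoint facet))

    peel-below : ∀ {m w} → InΔ (2 + m) w → (∀ k → β (2 + m) w k ℤ.< + N) → Peelable (suc m) w
    peel-below {m} {w} w∈ β<N with any? (λ j → β (2 + m) w (suc j) ℤP.≟ +0)
    ... | yes (j , βj≡0) = peel-facet (w∈ , βj≡0 , λ i → β<N (suc i)) (β<N zero)
    ... | no  ∄j         = peel-origin w∈ β<N (λ i βi≡0 → ∄j (i , βi≡0))

    peelable : ∀ m w → InΔ (2 + m) w → Peelable (suc m) w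
    peelable m w w∈ with any? (λ k → + N ℤP.≤? β (2 + m) w k)
    ... | yes (k , N≤βk) = peel-vertex k N≤βk w∈
    ... | no  ∄k         = peel-below w∈ (λ k → ℤP.≰⇒> (λ N≤βk → ∄k (k , N≤βk)))

    Cond⇒IDP : IDP (simplexVerts q)
    Cond⇒IDP = decomposable⇒IDP (decompose peelable)

theorem2p3 : (n : ℕ) (q : Fin n → ℕ) →
    (∀ i → 1 ≤ q i) →
    (∀ i j → i F.≤ j → q i ≤ q j) →
    (∀ j → q j ∣ suc (∑≠ j q)) →
    (IDP (simplexVerts q) → Cond q) × (Cond q → IDP (simplexVerts q))
theorem2p3 n q q≥1 _ q∣ = Face.IDP⇒Cond q≥1 q∣ , Face.Cond⇒IDP q≥1 q∣
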